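{- Let $\mathcal{P}=(V,P)$ be a finite poset and let $\chi(G_\mathcal{P})$ be the chromatic number of its underlying comparability graph $G_\mathcal{P}$, with $\chi(G_\mathcal{P})>1$. Then $\dim(\mathcal{P})\ge \dfrac{\mathrm{box}(G_\mathcal{P})}{\chi(G_\mathcal{P})-1}$.
   Context: The boxicity $\mathrm{box}(G)$ of a finite simple graph $G$ is the minimum integer $k$ such that vertices can be mapped to axis-parallel boxes in $\mathbb{R}^k$ (products of $k$ closed intervals) with two vertices adjacent iff their boxes intersect; a complete graph has boxicity $0$. The dimension $\dim(\mathcal{P})$ of a poset is the minimum number of linear extensions of $P$ whose intersection is $P$ (i.e. for distinct $x,y$: $x<y$ in $P$ iff $x<y$ in all of them). The underlying comparability graph $G_\mathcal{P}$ has vertex set $V$ and two distinct vertices are adjacent iff they are comparable in $P$. -}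

module Defs where

open import Data.Nat using (ℕ; _≤_)
open import Data.Fin using (Fin)
open import Data.Product using (Σ; _×_; ∃)
open import Data.Sum using (_⊎_)
open import Data.Rational as ℚ using (ℚ)
open import Relation.Nullary using (¬_)
open import Relation.Binary.PropositionalEquality using (_≡_; _≢_)
open import Relation.Binary.Structures using (IsDecPartialOrder; IsTotalOrder)
open import Function.Bundles using (_⇔_)

Rel : ℕ → Set₁
Rel n = Fin n → Fin n → Set

record FinPoset (n : ℕ) : Set₁ where
  field
    _≼_         : Rel n
    isPartialOrder : IsDecPartialOrder _≡_ _≼_
open FinPoset public

IsLinearExtension : ∀ {n} → FinPoset n → Rel n → Set
IsLinearExtension P L = IsTotalOrder _≡_ L × (∀ x y → _≼_ P x y → L x y)

-- A realizer of P of size k: k linear extensions whose intersection is P,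
-- i.e. for distinct x, y : x < y in P iff x < y in every L i.
-- (The "only if" direction is automatic from being extensions.)
IsRealizer : ∀ {n} → FinPoset n → (k : ℕ) → (Fin k → Rel n) → Set
IsRealizer {n} P k L =
  (∀ i → IsLinearExtension P (L i)) ×
  (∀ (x y : Fin n) → x ≢ y → ((∀ i → L i x y) ⇔ _≼_ P x y))

HasRealizerOfSize : ∀ {n} → FinPoset n → ℕ → Set₁
HasRealizerOfSize P k = Σ (Fin k → Rel _) λ L → IsRealizer P k L

IsDimension : ∀ {n} → FinPoset n → ℕ → Set₁
IsDimension P d = HasRealizerOfSize P d × (∀ k → HasRealizerOfSize P k → d ≤ k)

ComparabilityGraph : ∀ {n} → FinPoset n → Rel n
ComparabilityGraph P x y = x ≢ y × (_≼_ P x y ⊎ _≼_ P y x)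

IsProperColouring : ∀ {n} → Rel n → (c : ℕ) → (Fin n → Fin c) → Set
IsProperColouring E c f = ∀ x y → E x y → f x ≢ f y

Colourable : ∀ {n} → Rel n → ℕ → Set
Colourable {n} E c = Σ (Fin n → Fin c) λ f → IsProperColouring E c f

IsChromaticNumber : ∀ {n} → Rel n → ℕ → Set
IsChromaticNumber E χ = Colourable E χ × (∀ c → Colourable E c → χ ≤ c)

-- Boxicity.  A box in ℚ^k is given by lower/upper corners lo ≤ hi
-- (product of k closed intervals [lo i, hi i]).  Two boxes intersect iff
-- in every coordinate the closed intervals intersect.

BoxesIntersect : ∀ {k} → (Fin k → ℚ) → (Fin k → ℚ) → (Fin k → ℚ) → (Fin k → ℚ) → Set
BoxesIntersect lo₁ hi₁ lo₂ hi₂ = ∀ i → (lo₁ i ℚ.≤ hi₂ i) × (lo₂ i ℚ.≤ hi₁ i)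

IsBoxRepresentation : ∀ {n} → Rel n → (k : ℕ) → (Fin n → Fin k → ℚ) → (Fin n → Fin k → ℚ) → Set
IsBoxRepresentation {n} E k lo hi =
  (∀ x i → lo x i ℚ.≤ hi x i) ×
  (∀ (x y : Fin n) → x ≢ y → (E x y ⇔ BoxesIntersect (lo x) (hi x) (lo y) (hi y)))

HasBoxRepresentation : ∀ {n} → Rel n → ℕ → Set
HasBoxRepresentation {n} E k =
  Σ (Fin n → Fin k → ℚ) λ lo → Σ (Fin n → Fin k → ℚ) λ hi → IsBoxRepresentation E k lo hi

-- box(G) = b : minimum dimension of a box representation (complete graphs get 0).
IsBoxicity : ∀ {n} → Rel n → ℕ → Set
IsBoxicity E b = HasBoxRepresentation E b × (∀ k → HasBoxRepresentation E k → b ≤ k)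

-- Counting the colours that occur strictly below a vertex gives a level function that strictly
-- increases along the order and takes values in {0, …, χ−1}. Fix a realizer L₁, …, L_d and, for
-- each extension Lᵢ and threshold s, the interval graph in which v gets [rank v, n], the point
-- rank v, or [0, rank v] according as its level is below, equal to or above s (rank taken in Lᵢ).
-- Comparable vertices always meet. An incomparable pair x, y with level x ≤ level y is separated
-- by any extension putting y before x, at any threshold between the two levels, and a pair on a
-- common level is separated at that level by every extension. Hence d(χ−1) well-chosen pairs
-- (extension, threshold) already give a box representation.
module Submission where

open import Defs
open import Data.Nat using (ℕ; _≤_; _<_; _*_; _∸_)
open import Data.Nat as ℕ using (zero; suc; z≤n; s≤s; _<?_)
import Data.Nat.Properties as ℕ
open import Data.Nat.Coprimality as Coprime using (1-coprimeTo)
import Data.Integer as ℤ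
import Data.Integer.Properties as ℤ
open import Data.Rational as ℚ using (ℚ; mkℚ)
open import Data.Fin as Fin using (Fin; toℕ; fromℕ<; combine; remQuot)
import Data.Fin.Properties as Fin
open import Data.Fin.Subset using (Subset; _∈_; ∣_∣; ⊤)
open import Data.Fin.Subset.Properties using (p⊂q⇒∣p∣<∣q∣; ∣p∣≤n; ∣⊤∣≡n; ∈⊤)
open import Data.Vec using (tabulate)
open import Data.Vec.Properties using (lookup∘tabulate; lookup⇒[]=; []=⇒lookup)
open import Data.Empty using (⊥-elim)
open import Data.Product using (_×_; _,_; proj₁; proj₂; ∃; ∃₂; swap; map₂)
open import Data.Sum using (inj₁; inj₂; [_,_])
open import Function using (_∘_; id)
open import Function.Bundles using (_⇔_; mk⇔; Equivalence)
open import Relation.Nullary using (¬_; Dec; yes; no; does; ¬?)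
open import Relation.Nullary.Decidable using (dec-true; _×-dec_)
open import Relation.Unary using (Pred; Decidable)
open import Relation.Binary.Definitions using (tri<; tri≈; tri>)
open import Relation.Binary.Structures using (IsDecPartialOrder; IsTotalOrder)
open import Relation.Binary.Consequences using (total∧dec⇒dec)
open import Relation.Binary.PropositionalEquality
  using (_≡_; _≢_; refl; sym; trans; cong; subst; subst₂)

fromℕ : ℕ → ℚ
fromℕ k = mkℚ (ℤ.+ k) 0 (Coprime.sym (1-coprimeTo k))

fromℕ-mono-≤ : ∀ {a b} → a ≤ b → fromℕ a ℚ.≤ fromℕ b
fromℕ-mono-≤ {a} {b} a≤b =
  ℚ.*≤* (subst₂ ℤ._≤_ (sym (ℤ.*-identityʳ (ℤ.+ a))) (sym (ℤ.*-identityʳ (ℤ.+ b))) (ℤ.+≤+ a≤b))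

fromℕ-cancel-≤ : ∀ {a b} → fromℕ a ℚ.≤ fromℕ b → a ≤ b
fromℕ-cancel-≤ (ℚ.*≤* a≤b) = ℤ.drop‿+≤+ (subst₂ ℤ._≤_ (ℤ.*-identityʳ _) (ℤ.*-identityʳ _) a≤b)

toℕ-onto : ∀ {k s} → s < k → ∃ λ (t : Fin k) → toℕ t ≡ s
toℕ-onto s<k = fromℕ< s<k , Fin.toℕ-fromℕ< s<k

suc-toℕ-onto : ∀ {k s} → 0 < s → s < k → ∃ λ (t : Fin (k ∸ 1)) → suc (toℕ t) ≡ s
suc-toℕ-onto {s = suc _} _ s<k = map₂ (cong suc) (toℕ-onto (ℕ.pred-mono-≤ s<k))

ℕ-boxes⇒boxRepresentation : ∀ {n k} {E : Rel n} (lo hi : Fin n → Fin k → ℕ) →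
  (∀ v j → lo v j ≤ hi v j) →
  (∀ {x y} → x ≢ y → E x y ⇔ (∀ j → lo x j ≤ hi y j × lo y j ≤ hi x j)) →
  HasBoxRepresentation E k
ℕ-boxes⇒boxRepresentation lo hi lo≤hi adjacent⇔meet =
  (λ v j → fromℕ (lo v j)) , (λ v j → fromℕ (hi v j)) ,
  (λ v j → fromℕ-mono-≤ (lo≤hi v j)) ,
  λ x y x≢y → mk⇔
    (λ e j → let a , b = Equivalence.to (adjacent⇔meet x≢y) e j in fromℕ-mono-≤ a , fromℕ-mono-≤ b)
    (λ meet → Equivalence.from (adjacent⇔meet x≢y)
      λ j → let a , b = meet j in fromℕ-cancel-≤ a , fromℕ-cancel-≤ b)

module _ {n ℓ} {P : Pred (Fin n) ℓ} where

  subset : Decidable P → Subset n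
  subset P? = tabulate (does ∘ P?)

  ∈-subset⁺ : (P? : Decidable P) → ∀ {x} → P x → x ∈ subset P?
  ∈-subset⁺ P? {x} px = lookup⇒[]= x _ (trans (lookup∘tabulate _ x) (dec-true (P? x) px))

  ∈-subset⁻ : (P? : Decidable P) → ∀ {x} → x ∈ subset P? → P x
  ∈-subset⁻ P? {x} x∈ with P? x | trans (sym (lookup∘tabulate (does ∘ P?) x)) ([]=⇒lookup x∈)
  ... | yes px | _ = px
  ... | no _   | ()

module _ {n ℓ₁ ℓ₂} {P : Pred (Fin n) ℓ₁} {Q : Pred (Fin n) ℓ₂}
         (P? : Decidable P) (Q? : Decidable Q) (P⊆Q : ∀ {x} → P x → Q x) where

  ∣subset∣-mono-< : ∀ {x} → Q x → ¬ P x → ∣ subset P? ∣ < ∣ subset Q? ∣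
  ∣subset∣-mono-< {x} qx ¬px = p⊂q⇒∣p∣<∣q∣
    ( ∈-subset⁺ Q? ∘ P⊆Q ∘ ∈-subset⁻ P?
    , x , ∈-subset⁺ Q? qx , ¬px ∘ ∈-subset⁻ P?)

∣subset∣<n : ∀ {n ℓ} {P : Pred (Fin n) ℓ} (P? : Decidable P) {x} → ¬ P x → ∣ subset P? ∣ < n
∣subset∣<n {n} P? {x} ¬px = subst (∣ subset P? ∣ <_) (∣⊤∣≡n n)
  (p⊂q⇒∣p∣<∣q∣ ((λ _ → ∈⊤) , x , ∈⊤ , ¬px ∘ ∈-subset⁻ P?))

module Rank {n} {_⊑_ : Rel n} (isTotalOrder : IsTotalOrder _≡_ _⊑_) where
  open IsTotalOrder isTotalOrder using (reflexive; antisym; total) renaming (trans to ⊑-trans)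

  _⊑?_ : ∀ x y → Dec (x ⊑ y)
  _⊑?_ = total∧dec⇒dec reflexive antisym total Fin._≟_

  rank : Fin n → ℕ
  rank v = ∣ subset (_⊑? v) ∣

  rank≤n : ∀ v → rank v ≤ n
  rank≤n v = ∣p∣≤n (subset (_⊑? v))

  rank-mono-< : ∀ {x y} → x ⊑ y → x ≢ y → rank x < rank y
  rank-mono-< {x} {y} x⊑y x≢y =
    ∣subset∣-mono-< (_⊑? x) (_⊑? y) (λ u⊑x → ⊑-trans u⊑x x⊑y)
      (reflexive refl) (λ y⊑x → x≢y (antisym x⊑y y⊑x))

Strict : ∀ {n} → FinPoset n → Rel n
Strict P x y = _≼_ P x y × x ≢ y

≺-trans : ∀ {n} (P : FinPoset n) {x y z} → Strict P x y → Strict P y z → Strict P x z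
≺-trans P (x≼y , _) (y≼z , y≢z) = ≼-trans x≼y y≼z , λ { refl → y≢z (antisym y≼z x≼y) }
  where open IsDecPartialOrder (isPartialOrder P) using (antisym) renaming (trans to ≼-trans)

module Level {n} (P : FinPoset n) {c} (f : Fin n → Fin c)
             (proper : IsProperColouring (ComparabilityGraph P) c f) where
  open IsDecPartialOrder (isPartialOrder P) using (_≤?_)

  ColourBelow : Fin n → Pred (Fin c) _
  ColourBelow v κ = ∃ λ u → Strict P u v × f u ≡ κ

  colourBelow? : ∀ v → Decidable (ColourBelow v)
  colourBelow? v κ = Fin.any? λ u → ((u ≤? v) ×-dec ¬? (u Fin.≟ v)) ×-dec (f u Fin.≟ κ)

  level : Fin n → ℕ
  level v = ∣ subset (colourBelow? v) ∣

  own-colour-not-below : ∀ v → ¬ ColourBelow v (f v)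
  own-colour-not-below v (u , (u≼v , u≢v) , fu≡fv) = proper u v (u≢v , inj₁ u≼v) fu≡fv

  level-mono-< : ∀ {u v} → Strict P u v → level u < level v
  level-mono-< {u} {v} u≺v =
    ∣subset∣-mono-< (colourBelow? u) (colourBelow? v)
      (λ { (w , w≺u , fw≡κ) → w , ≺-trans P w≺u u≺v , fw≡κ })
      (u , u≺v , refl) (own-colour-not-below u)

  level<c : ∀ v → level v < c
  level<c v = ∣subset∣<n (colourBelow? v) (own-colour-not-below v)

module BoxRepresentation
    {n} (P : FinPoset n) {d} {L : Fin d → Rel n} (realizer : IsRealizer P d L)
    {m} (level : Fin n → ℕ) (level-mono-< : ∀ {u v} → Strict P u v → level u < level v)
    (level<m : ∀ v → level v < m) (1<m : 1 < m) where

  open IsDecPartialOrder (isPartialOrder P) using (_≤?_)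
  module L (i : Fin d) = IsTotalOrder (proj₁ (proj₁ realizer i))
  open module R (i : Fin d) = Rank (proj₁ (proj₁ realizer i)) using (rank; rank≤n; rank-mono-<)

  extension : ∀ i {x y} → _≼_ P x y → L i x y
  extension i = proj₂ (proj₁ realizer i) _ _

  reversed-by-extension : ∀ {x y} → x ≢ y → ¬ _≼_ P x y → ∃ λ i → L i y x
  reversed-by-extension {x} {y} x≢y x⋠y
    with Fin.¬∀⟶∃¬ d _ (λ i → R._⊑?_ i x y) (x⋠y ∘ Equivalence.to (proj₂ realizer x y x≢y))
  ... | i , ¬Lxy = i , [ ⊥-elim ∘ ¬Lxy , id ] (L.total i x y)

  lower : ℕ → Fin d → Fin n → ℕ
  lower s i v with s <? level v
  ... | yes _ = 0
  ... | no _  = rank i v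

  upper : ℕ → Fin d → Fin n → ℕ
  upper s i v with level v <? s
  ... | yes _ = n
  ... | no _  = rank i v

  lower≤rank : ∀ s i v → lower s i v ≤ rank i v
  lower≤rank s i v with s <? level v
  ... | yes _ = z≤n
  ... | no _  = ℕ.≤-refl

  rank≤upper : ∀ s i v → rank i v ≤ upper s i v
  rank≤upper s i v with level v <? s
  ... | yes _ = rank≤n i v
  ... | no _  = ℕ.≤-refl

  lower≡rank : ∀ {s} i {v} → level v ≤ s → lower s i v ≡ rank i v
  lower≡rank {s} i {v} lv≤s with s <? level v
  ... | yes s<lv = ⊥-elim (ℕ.≤⇒≯ lv≤s s<lv)
  ... | no _     = refl

  upper≡rank : ∀ {s} i {v} → s ≤ level v → upper s i v ≡ rank i v
  upper≡rank {s} i {v} s≤lv with level v <? s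
  ... | yes lv<s = ⊥-elim (ℕ.≤⇒≯ s≤lv lv<s)
  ... | no _     = refl

  Meet : ℕ → Fin d → Fin n → Fin n → Set
  Meet s i x y = lower s i x ≤ upper s i y × lower s i y ≤ upper s i x

  ≺⇒meet : ∀ s i {u v} → Strict P u v → Meet s i u v
  ≺⇒meet s i {u} {v} u≺v@(u≼v , u≢v) =
    ℕ.≤-trans (lower≤rank s i u)
      (ℕ.≤-trans (ℕ.<⇒≤ (rank-mono-< i (extension i u≼v) u≢v)) (rank≤upper s i v))
    , lower-above≤upper-below
    where
      lower-above≤upper-below : lower s i v ≤ upper s i u
      lower-above≤upper-below with s <? level v | level u <? s
      ... | yes _    | _        = z≤n
      ... | no _     | yes _    = rank≤n i v
      ... | no s≮lv  | no lu≮s  =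
        ⊥-elim (ℕ.<-irrefl refl (ℕ.<-≤-trans (level-mono-< u≺v)
          (ℕ.≤-trans (ℕ.≮⇒≥ s≮lv) (ℕ.≮⇒≥ lu≮s))))

  reversed⇒¬meet : ∀ {s} i {x y} → level x ≤ s → s ≤ level y → x ≢ y → L i y x → ¬ Meet s i x y
  reversed⇒¬meet i lx≤s s≤ly x≢y Lyx (lower-x≤upper-y , _) =
    ℕ.<⇒≱ (rank-mono-< i Lyx (x≢y ∘ sym))
      (subst₂ _≤_ (lower≡rank i lx≤s) (upper≡rank i s≤ly) lower-x≤upper-y)

  same-level⇒¬meet : ∀ {s} i {x y} → level x ≡ s → level y ≡ s → x ≢ y → ¬ Meet s i x y
  same-level⇒¬meet i {x} {y} refl ly≡s x≢y with L.total i x y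
  ... | inj₁ Lxy = reversed⇒¬meet i (ℕ.≤-reflexive ly≡s) ℕ.≤-refl (x≢y ∘ sym) Lxy ∘ swap
  ... | inj₂ Lyx = reversed⇒¬meet i ℕ.≤-refl (ℕ.≤-reflexive (sym ly≡s)) x≢y Lyx

  -- Extension 0 carries the thresholds 0, …, m−2 and every other extension 1, …, m−1: a pair on a
  -- common level ℓ > 0 is reversed by two distinct extensions, so one of them carries ℓ.
  threshold : Fin d → Fin (m ∸ 1) → ℕ
  threshold Fin.zero    t = toℕ t
  threshold (Fin.suc _) t = suc (toℕ t)

  separated-across-levels : ∀ i {x y} → level x < level y → x ≢ y → L i y x →
                            ∃ λ t → ¬ Meet (threshold i t) i x y
  separated-across-levels Fin.zero lx<ly x≢y Lyx
    with toℕ-onto (ℕ.<-≤-trans lx<ly (ℕ.pred-mono-≤ (level<m _)))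
  ... | t , t≡lx = t , reversed⇒¬meet Fin.zero (ℕ.≤-reflexive (sym t≡lx))
                         (ℕ.≤-trans (ℕ.≤-reflexive t≡lx) (ℕ.<⇒≤ lx<ly)) x≢y Lyx
  separated-across-levels (Fin.suc j) lx<ly x≢y Lyx
    with suc-toℕ-onto (ℕ.≤-trans (s≤s z≤n) lx<ly) (level<m _)
  ... | t , t+1≡ly = t , reversed⇒¬meet (Fin.suc j)
                          (ℕ.≤-trans (ℕ.<⇒≤ lx<ly) (ℕ.≤-reflexive (sym t+1≡ly)))
                          (ℕ.≤-reflexive t+1≡ly) x≢y Lyx

  threshold-attained : (i i′ : Fin d) → i ≢ i′ → ∀ {ℓ} → ℓ < m → ∃₂ λ j t → threshold j t ≡ ℓ
  threshold-attained Fin.zero    _ _ {zero} _ = Fin.zero , toℕ-onto (ℕ.pred-mono-≤ 1<m)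
  threshold-attained (Fin.suc _) _ _ {zero} _ = Fin.zero , toℕ-onto (ℕ.pred-mono-≤ 1<m)
  threshold-attained (Fin.suc j) _ _ {suc _} ℓ<m = Fin.suc j , suc-toℕ-onto (s≤s z≤n) ℓ<m
  threshold-attained Fin.zero (Fin.suc j) _ {suc _} ℓ<m = Fin.suc j , suc-toℕ-onto (s≤s z≤n) ℓ<m
  threshold-attained Fin.zero Fin.zero i≢i′ {suc _} _ = ⊥-elim (i≢i′ refl)

  incomparable⇒separated : ∀ {x y} → x ≢ y → ¬ _≼_ P x y → ¬ _≼_ P y x →
                           ∃₂ λ i t → ¬ Meet (threshold i t) i x y
  incomparable⇒separated {x} {y} x≢y x⋠y y⋠x
    with reversed-by-extension x≢y x⋠y | reversed-by-extension (x≢y ∘ sym) y⋠x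
       | ℕ.<-cmp (level x) (level y)
  ... | i , Lyx | _ , _ | tri< lx<ly _ _ = i , separated-across-levels i lx<ly x≢y Lyx
  ... | _ , _ | i′ , Lxy | tri> _ _ ly<lx =
    let t , ¬meet = separated-across-levels i′ ly<lx (x≢y ∘ sym) Lxy in i′ , t , ¬meet ∘ swap
  ... | i , Lyx | i′ , Lxy | tri≈ _ lx≡ly _ =
    let j , t , e = threshold-attained i i′ i≢i′ (level<m x)
    in j , t , same-level⇒¬meet j (sym e) (trans (sym lx≡ly) (sym e)) x≢y
    where
      i≢i′ : i ≢ i′
      i≢i′ refl = x≢y (L.antisym i Lxy Lyx)

  lowerAt upperAt : Fin d × Fin (m ∸ 1) → Fin n → ℕ
  lowerAt (i , t) = lower (threshold i t) i
  upperAt (i , t) = upper (threshold i t) i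

  lowerAt≤upperAt : ∀ c v → lowerAt c v ≤ upperAt c v
  lowerAt≤upperAt (i , t) v =
    ℕ.≤-trans (lower≤rank (threshold i t) i v) (rank≤upper (threshold i t) i v)

  MeetAt : Fin d × Fin (m ∸ 1) → Fin n → Fin n → Set
  MeetAt c x y = lowerAt c x ≤ upperAt c y × lowerAt c y ≤ upperAt c x

  adjacent⇔meet-everywhere : ∀ {x y} → x ≢ y → ComparabilityGraph P x y ⇔ (∀ c → MeetAt c x y)
  adjacent⇔meet-everywhere {x} {y} x≢y = mk⇔ adjacent⇒meet meet⇒adjacent
    where
      adjacent⇒meet : ComparabilityGraph P x y → ∀ c → MeetAt c x y
      adjacent⇒meet (_ , inj₁ x≼y) (i , t) = ≺⇒meet _ i (x≼y , x≢y)
      adjacent⇒meet (_ , inj₂ y≼x) (i , t) = swap (≺⇒meet _ i (y≼x , x≢y ∘ sym))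

      meet⇒adjacent : (∀ c → MeetAt c x y) → ComparabilityGraph P x y
      meet⇒adjacent meet with x ≤? y | y ≤? x
      ... | yes x≼y | _       = x≢y , inj₁ x≼y
      ... | no _    | yes y≼x = x≢y , inj₂ y≼x
      ... | no x⋠y  | no y⋠x  =
        let i , t , ¬meet = incomparable⇒separated x≢y x⋠y y⋠x in ⊥-elim (¬meet (meet (i , t)))

  boxRepresentation : HasBoxRepresentation (ComparabilityGraph P) (d * (m ∸ 1))
  boxRepresentation = ℕ-boxes⇒boxRepresentation
    (λ v k → lowerAt (remQuot (m ∸ 1) k) v) (λ v k → upperAt (remQuot (m ∸ 1) k) v)
    (λ v k → lowerAt≤upperAt (remQuot (m ∸ 1) k) v)
    λ {x} {y} x≢y → mk⇔
      (λ e k → Equivalence.to (adjacent⇔meet-everywhere x≢y) e (remQuot (m ∸ 1) k))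
      (λ meet → Equivalence.from (adjacent⇔meet-everywhere x≢y) λ (i , t) →
        subst (λ c → MeetAt c x y) (Fin.remQuot-combine i t) (meet (combine i t)))

theorem2 : (n : ℕ) (P : FinPoset n) (d χ b : ℕ) →
    IsDimension P d →
    IsChromaticNumber (ComparabilityGraph P) χ →
    IsBoxicity (ComparabilityGraph P) b →
    1 < χ →
    b ≤ d * (χ ∸ 1)
theorem2 _ P d χ _ ((_ , realizer) , _) ((f , proper) , _) (_ , boxicity-minimal) 1<χ =
  boxicity-minimal (d * (χ ∸ 1))
    (BoxRepresentation.boxRepresentation P realizer level level-mono-< level<c 1<χ)
  where open Level P f proper
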